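{- Let $G$ be a graph containing no member of $\mathcal{H}=\{C_6,C_6^1,C_6^2,C_6^3\}$ as an induced subgraph, and let $G^*$ be its auxiliary graph. Then $\chi_{cd}(G)=k(G^*)$.
   Context: Graphs are finite, simple, undirected, without isolated vertices. $C_6$ is the $6$-cycle, with bipartition into independent sets $A,B$ of size $3$; $C_6^1,C_6^2,C_6^3$ are obtained from $C_6$ by adding respectively $1,2,3$ edges among the three vertices of one of the two parts. The auxiliary graph $G^*$ has vertex set $V(G)$ and edge set $\{uv: d_G(u,v)=2\}$. $k(\cdot)$ denotes the clique cover number (minimum number of cliques partitioning the vertex set). A cd-colouring is a proper colouring in which every colour class $C$ satisfies $C\subseteq N_G(v)$ for some vertex $v$; $\chi_{cd}(G)$ is the minimum number of colours in a cd-colouring. -}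

module Defs where

open import Data.Nat using (ℕ; _≤_)
open import Data.Fin using (Fin; zero; suc)
open import Data.Bool using (Bool; true; false; T)
open import Data.Product using (Σ; ∃; ∃-syntax; _×_)
open import Relation.Nullary using (¬_)
open import Relation.Binary using (Decidable)
open import Relation.Binary.PropositionalEquality using (_≡_; _≢_)
open import Function.Bundles using (_⇔_)
open import Function.Definitions using (Injective)

record SimpleGraph (n : ℕ) : Set₁ where
  field
    Adj    : Fin n → Fin n → Set
    adj?   : Decidable Adj
    sym    : ∀ {u v} → Adj u v → Adj v u
    irrefl : ∀ {u} → ¬ Adj u u
open SimpleGraph public

-- Standing assumption of the paper: no isolated vertices.
NoIsolated : ∀ {n} → SimpleGraph n → Set
NoIsolated {n} G = ∀ (v : Fin n) → ∃[ u ] Adj G v u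

InducedSub : ∀ {m n} → SimpleGraph m → SimpleGraph n → Set
InducedSub {m} {n} H G =
  Σ (Fin m → Fin n) λ f →
    Injective _≡_ _≡_ f × (∀ i j → (Adj G (f i) (f j) ⇔ Adj H i j))

-- The 6-cycle 0-1-2-3-4-5-0, parts A = {0,2,4}, B = {1,3,5}, and the
-- graphs C6^1, C6^2, C6^3 obtained by adding the edges 02; 02,24; 02,24,04
-- inside the part A.  (Any choice of 1 or 2 edges gives an isomorphic graph.)
cycAdj : Fin 6 → Fin 6 → Bool
cycAdj zero (suc zero) = true
cycAdj (suc zero) (suc (suc zero)) = true
cycAdj (suc (suc zero)) (suc (suc (suc zero))) = true
cycAdj (suc (suc (suc zero))) (suc (suc (suc (suc zero)))) = true
cycAdj (suc (suc (suc (suc zero)))) (suc (suc (suc (suc (suc zero))))) = true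
cycAdj (suc (suc (suc (suc (suc zero))))) zero = true
cycAdj (suc zero) zero = true
cycAdj (suc (suc zero)) (suc zero) = true
cycAdj (suc (suc (suc zero))) (suc (suc zero)) = true
cycAdj (suc (suc (suc (suc zero)))) (suc (suc (suc zero))) = true
cycAdj (suc (suc (suc (suc (suc zero))))) (suc (suc (suc (suc zero)))) = true
cycAdj zero (suc (suc (suc (suc (suc zero))))) = true
cycAdj _ _ = false

chordAdj : Bool → Bool → Bool → Fin 6 → Fin 6 → Bool
chordAdj a b c zero (suc (suc zero)) = a
chordAdj a b c (suc (suc zero)) zero = a
chordAdj a b c (suc (suc zero)) (suc (suc (suc (suc zero)))) = b
chordAdj a b c (suc (suc (suc (suc zero)))) (suc (suc zero)) = b
chordAdj a b c zero (suc (suc (suc (suc zero)))) = c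
chordAdj a b c (suc (suc (suc (suc zero)))) zero = c
chordAdj a b c _ _ = false

or : Bool → Bool → Bool
or true _ = true
or false b = b

hexAdj : Bool → Bool → Bool → Fin 6 → Fin 6 → Bool
hexAdj a b c i j = or (cycAdj i j) (chordAdj a b c i j)

T? : ∀ b → Relation.Nullary.Dec (T b)
T? true = Relation.Nullary.yes _
T? false = Relation.Nullary.no (λ ())

hexSym : ∀ a b c (i j : Fin 6) → T (hexAdj a b c i j) → T (hexAdj a b c j i)
hexSym a b c zero zero p = p
hexSym a b c zero (suc zero) p = p
hexSym a b c zero (suc (suc zero)) p = p
hexSym a b c zero (suc (suc (suc zero))) p = p
hexSym a b c zero (suc (suc (suc (suc zero)))) p = p
hexSym a b c zero (suc (suc (suc (suc (suc zero))))) p = p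
hexSym a b c (suc zero) zero p = p
hexSym a b c (suc zero) (suc zero) p = p
hexSym a b c (suc zero) (suc (suc zero)) p = p
hexSym a b c (suc zero) (suc (suc (suc zero))) p = p
hexSym a b c (suc zero) (suc (suc (suc (suc zero)))) p = p
hexSym a b c (suc zero) (suc (suc (suc (suc (suc zero))))) p = p
hexSym a b c (suc (suc zero)) zero p = p
hexSym a b c (suc (suc zero)) (suc zero) p = p
hexSym a b c (suc (suc zero)) (suc (suc zero)) p = p
hexSym a b c (suc (suc zero)) (suc (suc (suc zero))) p = p
hexSym a b c (suc (suc zero)) (suc (suc (suc (suc zero)))) p = p
hexSym a b c (suc (suc zero)) (suc (suc (suc (suc (suc zero))))) p = p
hexSym a b c (suc (suc (suc zero))) zero p = p
hexSym a b c (suc (suc (suc zero))) (suc zero) p = p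
hexSym a b c (suc (suc (suc zero))) (suc (suc zero)) p = p
hexSym a b c (suc (suc (suc zero))) (suc (suc (suc zero))) p = p
hexSym a b c (suc (suc (suc zero))) (suc (suc (suc (suc zero)))) p = p
hexSym a b c (suc (suc (suc zero))) (suc (suc (suc (suc (suc zero))))) p = p
hexSym a b c (suc (suc (suc (suc zero)))) zero p = p
hexSym a b c (suc (suc (suc (suc zero)))) (suc zero) p = p
hexSym a b c (suc (suc (suc (suc zero)))) (suc (suc zero)) p = p
hexSym a b c (suc (suc (suc (suc zero)))) (suc (suc (suc zero))) p = p
hexSym a b c (suc (suc (suc (suc zero)))) (suc (suc (suc (suc zero)))) p = p
hexSym a b c (suc (suc (suc (suc zero)))) (suc (suc (suc (suc (suc zero))))) p = p
hexSym a b c (suc (suc (suc (suc (suc zero))))) zero p = p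
hexSym a b c (suc (suc (suc (suc (suc zero))))) (suc zero) p = p
hexSym a b c (suc (suc (suc (suc (suc zero))))) (suc (suc zero)) p = p
hexSym a b c (suc (suc (suc (suc (suc zero))))) (suc (suc (suc zero))) p = p
hexSym a b c (suc (suc (suc (suc (suc zero))))) (suc (suc (suc (suc zero)))) p = p
hexSym a b c (suc (suc (suc (suc (suc zero))))) (suc (suc (suc (suc (suc zero))))) p = p

hexIrr : ∀ a b c (i : Fin 6) → ¬ T (hexAdj a b c i i)
hexIrr a b c zero ()
hexIrr a b c (suc zero) ()
hexIrr a b c (suc (suc zero)) ()
hexIrr a b c (suc (suc (suc zero))) ()
hexIrr a b c (suc (suc (suc (suc zero)))) ()
hexIrr a b c (suc (suc (suc (suc (suc zero))))) ()

hex : Bool → Bool → Bool → SimpleGraph 6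
hex a b c = record
  { Adj = λ i j → T (hexAdj a b c i j)
  ; adj? = λ i j → T? (hexAdj a b c i j)
  ; sym = λ {i} {j} → hexSym a b c i j
  ; irrefl = λ {i} → hexIrr a b c i
  }

C6 C6¹ C6² C6³ : SimpleGraph 6
C6  = hex false false false
C6¹ = hex true  false false
C6² = hex true  true  false
C6³ = hex true  true  true

ℋ-free : ∀ {n} → SimpleGraph n → Set
ℋ-free G = ¬ InducedSub C6 G × ¬ InducedSub C6¹ G × ¬ InducedSub C6² G × ¬ InducedSub C6³ G

-- d_G(u,v) = 2 : distinct, non-adjacent, with a common neighbour.
-- This is the adjacency relation of the auxiliary graph G*.
Dist2 : ∀ {n} → SimpleGraph n → Fin n → Fin n → Set
Dist2 G u v = u ≢ v × ¬ Adj G u v × ∃[ w ] (Adj G u w × Adj G w v)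

-- A partition of the vertex set into (at most) k cliques of the relation R,
-- given by the class map c (empty classes allowed; irrelevant for the minimum).
CliqueCover : ∀ {n} → (Fin n → Fin n → Set) → ℕ → Set
CliqueCover {n} R k =
  Σ (Fin n → Fin k) λ c → ∀ u v → u ≢ v → c u ≡ c v → R u v

CdColouring : ∀ {n} → SimpleGraph n → ℕ → Set
CdColouring {n} G k =
  Σ (Fin n → Fin k) λ c →
    (∀ u v → Adj G u v → c u ≢ c v) ×
    (∀ (i : Fin k) → ∃[ v ] (∀ u → c u ≡ i → Adj G u v))

IsMinimum : (ℕ → Set) → ℕ → Set
IsMinimum P m = P m × (∀ k → P k → m ≤ k)

χcd≡ : ∀ {n} → SimpleGraph n → ℕ → Set
χcd≡ G m = IsMinimum (CdColouring G) m

kAux≡ : ∀ {n} → SimpleGraph n → ℕ → Set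
kAux≡ G m = IsMinimum (CliqueCover (Dist2 G)) m

{-# OPTIONS --safe #-}
module Submission where

open import Defs
open import Data.Nat using (ℕ; zero; suc; _≤_; z≤n; s≤s)
open import Data.Nat.Properties using (≤-trans; ≤-antisym; ≤-refl)
open import Data.Fin using (Fin; _<_) renaming (zero to fz; suc to fs)
open import Data.Fin.Properties using (_≟_; <-cmp; all?; any?)
open import Data.Bool using (Bool; true; false; T)
open import Data.Empty using (⊥-elim)
open import Data.Product using (∃-syntax; _×_; _,_; proj₁; proj₂)
open import Data.Sum using (_⊎_; inj₁; inj₂)
open import Data.List using (List; []; _∷_; filter; allFin)
open import Data.List.Membership.Propositional.Properties using (∈-filter⁺; ∈-allFin)
open import Data.List.Relation.Unary.All as All using (All; []; _∷_)
open import Data.List.Relation.Unary.All.Properties using (all-filter)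
open import Data.List.Relation.Unary.AllPairs as AllPairs using (AllPairs; []; _∷_)
import Data.List.Relation.Unary.AllPairs.Properties as AllPairs
open import Data.List.Relation.Unary.Unique.Propositional.Properties using (allFin⁺)
open import Relation.Nullary using (¬_; Dec; yes; no)
open import Relation.Nullary.Decidable using (_×-dec_; _⊎-dec_; _→-dec_; ¬?; from-yes)
open import Relation.Binary using (tri<; tri≈; tri>)
open import Relation.Binary.PropositionalEquality using (_≡_; _≢_; refl; trans; subst)
  renaming (sym to ≡-sym)
open import Function using (_∘_)
open import Function.Bundles using (_⇔_; mk⇔; Equivalence)
open import Function.Definitions using (Injective)

-- A cd-colouring is a clique cover of G*: two vertices of one colour class
-- are non-adjacent with a common neighbour.  Conversely, a clique C of G*
-- has a common neighbour: dropping any one of three vertices a, b, c of C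
-- leaves, by induction, common neighbours x, y, z of the rest; if none of
-- them is adjacent to the dropped vertex, then a z b x c y is an induced
-- 6-cycle whose only possible chords lie in {x, y, z}, i.e. a copy of a
-- member of ℋ.  So both minima range over the same numbers.

IsMinimum-⇔ : {P Q : ℕ → Set} → (∀ {k} → P k → Q k) →
              (∀ {k} → Q k → ∃[ k′ ] k′ ≤ k × P k′) →
              ∀ m → IsMinimum P m ⇔ IsMinimum Q m
IsMinimum-⇔ {P} {Q} P⇒Q Q⇒P m = mk⇔ to from
  where
  to : IsMinimum P m → IsMinimum Q m
  to (Pm , minimal) = P⇒Q Pm , λ k Qk →
    let (k′ , k′≤k , Pk′) = Q⇒P Qk in ≤-trans (minimal k′ Pk′) k′≤k
  from : IsMinimum Q m → IsMinimum P m
  from (Qm , minimal) with Q⇒P Qm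
  ... | k′ , k′≤m , Pk′ =
    subst P (≤-antisym k′≤m (minimal k′ (P⇒Q Pk′))) Pk′ , λ k Pk → minimal k (P⇒Q Pk)

⇔-true : {A : Set} → A → A ⇔ T true
⇔-true a = mk⇔ _ λ _ → a

⇔-false : {A : Set} → ¬ A → A ⇔ T false
⇔-false ¬a = mk⇔ ¬a λ ()

AllPairs-restrict : {A : Set} {P : A → Set} {R : A → A → Set} {xs : List A} →
                    All P xs → AllPairs (λ u v → P u → P v → R u v) xs → AllPairs R xs
AllPairs-restrict [] [] = []
AllPairs-restrict (Pu ∷ Pxs) (Ru ∷ Rxs) =
  All.zipWith (λ (Pv , R) → R Pu Pv) (Pxs , Ru) ∷ AllPairs-restrict Pxs Rxs

PointDetermining : ∀ {m} → SimpleGraph m → Set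
PointDetermining {m} H =
  ∀ i j → i ≢ j → ∃[ k ] (Adj H k i × ¬ Adj H k j ⊎ ¬ Adj H k i × Adj H k j)

pointDetermining? : ∀ {m} (H : SimpleGraph m) → Dec (PointDetermining H)
pointDetermining? H = all? λ i → all? λ j → ¬? (i ≟ j) →-dec any? λ k →
  adj? H k i ×-dec ¬? (adj? H k j) ⊎-dec ¬? (adj? H k i) ×-dec adj? H k j

hex-pointDetermining : ∀ p q r → PointDetermining (hex p q r)
hex-pointDetermining false false false = from-yes (pointDetermining? (hex false false false))
hex-pointDetermining false false true  = from-yes (pointDetermining? (hex false false true))
hex-pointDetermining false true  false = from-yes (pointDetermining? (hex false true  false))
hex-pointDetermining false true  true  = from-yes (pointDetermining? (hex false true  true))
hex-pointDetermining true  false false = from-yes (pointDetermining? (hex true  false false))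
hex-pointDetermining true  false true  = from-yes (pointDetermining? (hex true  false true))
hex-pointDetermining true  true  false = from-yes (pointDetermining? (hex true  true  false))
hex-pointDetermining true  true  true  = from-yes (pointDetermining? (hex true  true  true))

module _ {m n} (H : SimpleGraph m) (G : SimpleGraph n) (f : Fin m → Fin n) where

  ReflectsAdj : Set
  ReflectsAdj = ∀ i j → Adj G (f i) (f j) ⇔ Adj H i j

  ReflectsAdj-from-< : (∀ i j → i < j → Adj G (f i) (f j) ⇔ Adj H i j) → ReflectsAdj
  ReflectsAdj-from-< increasing i j with <-cmp i j
  ... | tri< i<j _ _ = increasing i j i<j
  ... | tri≈ _ refl _ = mk⇔ (⊥-elim ∘ irrefl G) (⊥-elim ∘ irrefl H)
  ... | tri> _ _ j<i = mk⇔ (sym H ∘ to ∘ sym G) (sym G ∘ from ∘ sym H)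
    where open Equivalence (increasing j i j<i)

  ReflectsAdj⇒Injective : ReflectsAdj → PointDetermining H → Injective _≡_ _≡_ f
  ReflectsAdj⇒Injective reflects separated {i} {j} fi≡fj with i ≟ j
  ... | yes i≡j = i≡j
  ... | no i≢j with separated i j i≢j
  ... | k , inj₁ (k~i , k≁j) = ⊥-elim (k≁j (to (subst (Adj G (f k)) fi≡fj (from k~i))))
    where open Equivalence (reflects k j) using (to)
          open Equivalence (reflects k i) using (from)
  ... | k , inj₂ (k≁i , k~j) = ⊥-elim (k≁i (to (subst (Adj G (f k)) (≡-sym fi≡fj) (from k~j))))
    where open Equivalence (reflects k i) using (to)
          open Equivalence (reflects k j) using (from)

  ReflectsAdj⇒InducedSub : ReflectsAdj → PointDetermining H → InducedSub H G
  ReflectsAdj⇒InducedSub reflects separated =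
    f , ReflectsAdj⇒Injective reflects separated , reflects

module _ {n} (G : SimpleGraph n) where

  adj⇒≢ : ∀ {u v} → Adj G u v → u ≢ v
  adj⇒≢ u~v refl = irrefl G u~v

  dist2⇒nonadj : ∀ {u v} → Dist2 G u v → ¬ Adj G u v
  dist2⇒nonadj = proj₁ ∘ proj₂

  record Hexagon (a b c x y z : Fin n) : Set where
    field
      a≁b : ¬ Adj G a b
      b≁c : ¬ Adj G b c
      a≁c : ¬ Adj G a c
      b~x : Adj G b x
      c~x : Adj G c x
      a≁x : ¬ Adj G a x
      a~y : Adj G a y
      c~y : Adj G c y
      b≁y : ¬ Adj G b y
      a~z : Adj G a z
      b~z : Adj G b z
      c≁z : ¬ Adj G c z

  rotate : ∀ {a b c x y z} → Hexagon a b c x y z → Hexagon b c a y z x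
  rotate h = record
    { a≁b = b≁c ; b≁c = a≁c ∘ sym G ; a≁c = a≁b ∘ sym G
    ; b~x = c~y ; c~x = a~y ; a≁x = b≁y
    ; a~y = b~z ; c~y = a~z ; b≁y = c≁z
    ; a~z = b~x ; b~z = c~x ; c≁z = a≁x }
    where open Hexagon h

  reflect : ∀ {a b c x y z} → Hexagon a b c x y z → Hexagon a c b x z y
  reflect h = record
    { a≁b = a≁c ; b≁c = b≁c ∘ sym G ; a≁c = a≁b
    ; b~x = c~x ; c~x = b~x ; a≁x = a≁x
    ; a~y = a~z ; c~y = b~z ; b≁y = c≁z
    ; a~z = a~y ; b~z = c~y ; c≁z = b≁y }
    where open Hexagon h

  Hexagon⇒InducedSub : ∀ {a b c x y z p q r} → Hexagon a b c x y z →
                       Adj G x y ⇔ T p → Adj G y z ⇔ T q → Adj G x z ⇔ T r →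
                       InducedSub (hex p q r) G
  Hexagon⇒InducedSub {a} {b} {c} {x} {y} {z} {p} {q} {r} h x∼y y∼z x∼z =
    ReflectsAdj⇒InducedSub (hex p q r) G vertex
      (ReflectsAdj-from-< (hex p q r) G vertex increasing) (hex-pointDetermining p q r)
    where
    open Hexagon h
    vertex : Fin 6 → Fin n
    vertex fz = x
    vertex (fs fz) = c
    vertex (fs (fs fz)) = y
    vertex (fs (fs (fs fz))) = a
    vertex (fs (fs (fs (fs fz)))) = z
    vertex (fs (fs (fs (fs (fs fz))))) = b
    increasing : ∀ i j → i < j → Adj G (vertex i) (vertex j) ⇔ T (hexAdj p q r i j)
    increasing fz (fs fz) _ = ⇔-true (sym G c~x)
    increasing fz (fs (fs fz)) _ = x∼y
    increasing fz (fs (fs (fs fz))) _ = ⇔-false (a≁x ∘ sym G)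
    increasing fz (fs (fs (fs (fs fz)))) _ = x∼z
    increasing fz (fs (fs (fs (fs (fs fz))))) _ = ⇔-true (sym G b~x)
    increasing (fs fz) (fs (fs fz)) _ = ⇔-true c~y
    increasing (fs fz) (fs (fs (fs fz))) _ = ⇔-false (a≁c ∘ sym G)
    increasing (fs fz) (fs (fs (fs (fs fz)))) _ = ⇔-false c≁z
    increasing (fs fz) (fs (fs (fs (fs (fs fz))))) _ = ⇔-false (b≁c ∘ sym G)
    increasing (fs (fs fz)) (fs (fs (fs fz))) _ = ⇔-true (sym G a~y)
    increasing (fs (fs fz)) (fs (fs (fs (fs fz)))) _ = y∼z
    increasing (fs (fs fz)) (fs (fs (fs (fs (fs fz))))) _ = ⇔-false (b≁y ∘ sym G)
    increasing (fs (fs (fs fz))) (fs (fs (fs (fs fz)))) _ = ⇔-true a~z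
    increasing (fs (fs (fs fz))) (fs (fs (fs (fs (fs fz))))) _ = ⇔-false a≁b
    increasing (fs (fs (fs (fs fz)))) (fs (fs (fs (fs (fs fz))))) _ = ⇔-true (sym G b~z)
    increasing (fs _) (fs fz) (s≤s ())
    increasing (fs (fs _)) (fs (fs fz)) (s≤s (s≤s ()))
    increasing (fs (fs (fs _))) (fs (fs (fs fz))) (s≤s (s≤s (s≤s ())))
    increasing (fs (fs (fs (fs _)))) (fs (fs (fs (fs fz)))) (s≤s (s≤s (s≤s (s≤s ()))))
    increasing (fs (fs (fs (fs (fs _))))) (fs (fs (fs (fs (fs fz))))) (s≤s (s≤s (s≤s (s≤s (s≤s ())))))

  -- The eight chord patterns on {x, y, z} reduce to the four members of ℋ
  -- by rotating and reflecting the hexagon.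
  ℋ-free⇒¬Hexagon : ℋ-free G → ∀ {a b c x y z} → ¬ Hexagon a b c x y z
  ℋ-free⇒¬Hexagon (no-C6 , no-C6¹ , no-C6² , no-C6³) {x = x} {y} {z} h
    with adj? G x y | adj? G y z | adj? G x z
  ... | no x≁y | no y≁z | no x≁z =
    no-C6 (Hexagon⇒InducedSub h (⇔-false x≁y) (⇔-false y≁z) (⇔-false x≁z))
  ... | yes x~y | no y≁z | no x≁z =
    no-C6¹ (Hexagon⇒InducedSub h (⇔-true x~y) (⇔-false y≁z) (⇔-false x≁z))
  ... | no x≁y | yes y~z | no x≁z =
    no-C6¹ (Hexagon⇒InducedSub (rotate h) (⇔-true y~z) (⇔-false (x≁z ∘ sym G)) (⇔-false (x≁y ∘ sym G)))
  ... | no x≁y | no y≁z | yes x~z =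
    no-C6¹ (Hexagon⇒InducedSub (rotate (rotate h)) (⇔-true (sym G x~z)) (⇔-false x≁y) (⇔-false (y≁z ∘ sym G)))
  ... | yes x~y | yes y~z | no x≁z =
    no-C6² (Hexagon⇒InducedSub h (⇔-true x~y) (⇔-true y~z) (⇔-false x≁z))
  ... | no x≁y | yes y~z | yes x~z =
    no-C6² (Hexagon⇒InducedSub (reflect h) (⇔-true x~z) (⇔-true (sym G y~z)) (⇔-false x≁y))
  ... | yes x~y | no y≁z | yes x~z =
    no-C6² (Hexagon⇒InducedSub (reflect (rotate h)) (⇔-true (sym G x~y)) (⇔-true x~z) (⇔-false y≁z))
  ... | yes x~y | yes y~z | yes x~z =
    no-C6³ (Hexagon⇒InducedSub h (⇔-true x~y) (⇔-true y~z) (⇔-true x~z))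

  HasCommonNeighbour : List (Fin n) → Set
  HasCommonNeighbour xs = ∃[ w ] All (λ u → Adj G u w) xs

  module _ (noHexagon : ∀ {a b c x y z} → ¬ Hexagon a b c x y z) where

    AllPairs-Dist2⇒HasCommonNeighbour : ∀ a b rest → AllPairs (Dist2 G) (a ∷ b ∷ rest) →
                                        HasCommonNeighbour (a ∷ b ∷ rest)
    AllPairs-Dist2⇒HasCommonNeighbour a b [] (((_ , _ , w , a~w , w~b) ∷ []) ∷ [] ∷ []) =
      w , a~w ∷ sym G w~b ∷ []
    AllPairs-Dist2⇒HasCommonNeighbour a b (c ∷ rest)
      ((ab ∷ ac ∷ a-rest) ∷ (bc ∷ b-rest) ∷ c-rest ∷ rest-pairs)
      with AllPairs-Dist2⇒HasCommonNeighbour b c rest ((bc ∷ b-rest) ∷ c-rest ∷ rest-pairs)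
         | AllPairs-Dist2⇒HasCommonNeighbour a c rest ((ac ∷ a-rest) ∷ c-rest ∷ rest-pairs)
         | AllPairs-Dist2⇒HasCommonNeighbour a b rest ((ab ∷ a-rest) ∷ b-rest ∷ rest-pairs)
    ... | x , b~x ∷ c~x ∷ rest~x | y , a~y ∷ c~y ∷ rest~y | z , a~z ∷ b~z ∷ rest~z
      with adj? G a x | adj? G b y | adj? G c z
    ... | yes a~x | _ | _ = x , a~x ∷ b~x ∷ c~x ∷ rest~x
    ... | no _ | yes b~y | _ = y , a~y ∷ b~y ∷ c~y ∷ rest~y
    ... | no _ | no _ | yes c~z = z , a~z ∷ b~z ∷ c~z ∷ rest~z
    ... | no a≁x | no b≁y | no c≁z = ⊥-elim (noHexagon {a} {b} {c} {x} {y} {z} record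
      { a≁b = dist2⇒nonadj ab ; b≁c = dist2⇒nonadj bc ; a≁c = dist2⇒nonadj ac
      ; b~x = b~x ; c~x = c~x ; a≁x = a≁x
      ; a~y = a~y ; c~y = c~y ; b≁y = b≁y
      ; a~z = a~z ; b~z = b~z ; c≁z = c≁z })

    -- A class with fewer than two vertices is dominated by any neighbour of
    -- its vertex, or, when empty, by the given vertex v₀.
    cliqueCover⇒cdColouring : Fin n → NoIsolated G → ∀ {k} →
                              CliqueCover (Dist2 G) k → CdColouring G k
    cliqueCover⇒cdColouring v₀ noIsolated (colour , clique) = colour , proper , dominated
      where
      proper : ∀ u v → Adj G u v → colour u ≢ colour v
      proper u v u~v same = dist2⇒nonadj (clique u v (adj⇒≢ u~v) same) u~v
      pairwise : ∀ i → AllPairs (Dist2 G) (filter (λ u → colour u ≟ i) (allFin n))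
      pairwise i = AllPairs-restrict (all-filter (λ u → colour u ≟ i) (allFin n))
        (AllPairs.filter⁺ (λ u → colour u ≟ i)
          (AllPairs.map (λ u≢v cu≡i cv≡i → clique _ _ u≢v (trans cu≡i (≡-sym cv≡i))) (allFin⁺ n)))
      commonNeighbour : ∀ xs → AllPairs (Dist2 G) xs → HasCommonNeighbour xs
      commonNeighbour [] _ = v₀ , []
      commonNeighbour (a ∷ []) _ = let (w , a~w) = noIsolated a in w , a~w ∷ []
      commonNeighbour (a ∷ b ∷ rest) = AllPairs-Dist2⇒HasCommonNeighbour a b rest
      dominated : ∀ i → ∃[ w ] (∀ u → colour u ≡ i → Adj G u w)
      dominated i =
        let (w , class~w) = commonNeighbour _ (pairwise i)
        in w , λ u cu≡i → All.lookup class~w (∈-filter⁺ (λ u → colour u ≟ i) (∈-allFin u) cu≡i)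

  cdColouring⇒cliqueCover : ∀ {k} → CdColouring G k → CliqueCover (Dist2 G) k
  cdColouring⇒cliqueCover (colour , proper , dominated) = colour , λ u v u≢v same →
    let (w , class~w) = dominated (colour v) in
    u≢v , (λ u~v → proper u v u~v same) , w , class~w u same , sym G (class~w v refl)

-- Without vertices every colour class would need a dominating vertex, so
-- only the empty colouring is a cd-colouring: χ_cd = 0 ≤ k.
cliqueCover⇒smallerCdColouring : ∀ {n} (G : SimpleGraph n) → NoIsolated G → ℋ-free G →
                                 ∀ {k} → CliqueCover (Dist2 G) k → ∃[ k′ ] k′ ≤ k × CdColouring G k′
cliqueCover⇒smallerCdColouring {zero} G _ _ _ = 0 , z≤n , (λ ()) , (λ ()) , (λ ())
cliqueCover⇒smallerCdColouring {suc n} G noIsolated free {k} cover =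
  k , ≤-refl , cliqueCover⇒cdColouring G (ℋ-free⇒¬Hexagon G free) fz noIsolated cover

theorem8 : ∀ {n : ℕ} (G : SimpleGraph n) → NoIsolated G → ℋ-free G →
           ∀ (m : ℕ) → (χcd≡ G m ⇔ kAux≡ G m)
theorem8 G noIsolated free =
  IsMinimum-⇔ (cdColouring⇒cliqueCover G) (cliqueCover⇒smallerCdColouring G noIsolated free)
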